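{- In a graph of diameter two, no terminal set is an independent set.
   Context: A set $S \subseteq V(G)$ is in general position if no shortest path of $G$ contains three vertices of $S$. A terminal set of $G$ is a general position set $S$ that is maximal under inclusion and such that for every $u \in V(G)\setminus S$ there is a shortest path of $G$ with $u$ as an endpoint containing at least two vertices of $S$. -}

module Defs where

open import Level using (0ℓ)
open import Data.Nat using (ℕ; zero; suc; _≤_)
open import Data.Fin using (Fin)
open import Data.Product using (Σ; proj₁; ∃; ∃-syntax; _×_; _,_)
open import Relation.Nullary using (¬_; Dec)
open import Relation.Unary using (Pred; _∈_; _∉_; _⊆_)
open import Relation.Binary.PropositionalEquality using (_≡_)

record Graph : Set₁ where
  field
    n      : ℕ
    Adj    : Fin n → Fin n → Set
    adj?   : ∀ u v → Dec (Adj u v)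
    sym    : ∀ {u v} → Adj u v → Adj v u
    irrefl : ∀ {u} → ¬ Adj u u

module _ (G : Graph) where
  open Graph G

  V : Set
  V = Fin n

  data Walk : V → V → ℕ → Set where
    [_]  : (u : V) → Walk u u zero
    _∷_  : ∀ {u w v k} → Adj u w → Walk w v k → Walk u v (suc k)

  data _OnWalk_ (x : V) : ∀ {u v k} → Walk u v k → Set where
    here-end : x OnWalk [ x ]
    here     : ∀ {w v k} (a : Adj x w) (p : Walk w v k) → x OnWalk (a ∷ p)
    there    : ∀ {u w v k} (a : Adj u w) {p : Walk w v k} → x OnWalk p → x OnWalk (a ∷ p)

  Shortest : ∀ {u v k} → Walk u v k → Set
  Shortest {u} {v} {k} _ = ∀ m → Walk u v m → k ≤ m

  Dist : V → V → ℕ → Set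
  Dist u v k = Σ (Walk u v k) Shortest

  HasDiameter : ℕ → Set
  HasDiameter d = (∀ u v → ∃[ k ] (k ≤ d × Dist u v k)) × (∃[ u ] ∃[ v ] Dist u v d)

  ContainsThree : Pred V 0ℓ → ∀ {u v k} → Walk u v k → Set
  ContainsThree S p = ∃[ x ] ∃[ y ] ∃[ z ]
    (x ∈ S × y ∈ S × z ∈ S × ¬ x ≡ y × ¬ x ≡ z × ¬ y ≡ z ×
     x OnWalk p × y OnWalk p × z OnWalk p)

  ContainsTwo : Pred V 0ℓ → ∀ {u v k} → Walk u v k → Set
  ContainsTwo S p = ∃[ x ] ∃[ y ] (x ∈ S × y ∈ S × ¬ x ≡ y × x OnWalk p × y OnWalk p)

  GeneralPosition : Pred V 0ℓ → Set
  GeneralPosition S = ∀ {u v k} (p : Walk u v k) → Shortest p → ¬ ContainsThree S p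

  MaximalGP : Pred V 0ℓ → Set₁
  MaximalGP S = GeneralPosition S × (∀ T → GeneralPosition T → S ⊆ T → T ⊆ S)

  Terminal : Pred V 0ℓ → Set₁
  Terminal S = MaximalGP S ×
    (∀ u → u ∉ S → ∃[ v ] ∃[ k ] Σ (Walk u v k) (λ p → Shortest p × ContainsTwo S p))

  Independent : Pred V 0ℓ → Set
  Independent S = ∀ {x y} → x ∈ S → y ∈ S → ¬ Adj x y

-- If u ∉ S, terminality gives a shortest path from u carrying two vertices of S;
-- in diameter two it has at most two edges, so those two vertices are the other
-- vertices of the path, which are consecutive and hence adjacent.  Thus an
-- independent terminal set misses no vertex, yet a graph of diameter two has an
-- edge, whose ends would then be two adjacent vertices of S.
module Submission where

open import Defs
open import Level using (0ℓ)
open import Data.Nat using (_≤_; s≤s)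
open import Data.Nat.Properties using (≤-trans)
open import Data.Empty using (⊥-elim)
open import Data.Product using (_,_)
open import Relation.Nullary using (¬_)
open import Relation.Unary using (Pred; _∈_; _∉_)
open import Relation.Binary.PropositionalEquality using (_≢_; refl)

module _ (G : Graph) where
  open Graph G renaming (sym to Adj-sym)

  distinct-on-edge⇒adjacent : ∀ {w v k x y} (p : Walk G w v k) → k ≤ 1 →
    _OnWalk_ G x p → _OnWalk_ G y p → x ≢ y → Adj x y
  distinct-on-edge⇒adjacent [ w ]       _ here-end           here-end           x≢y = ⊥-elim (x≢y refl)
  distinct-on-edge⇒adjacent (b ∷ [ z ]) _ (here _ _)         (here _ _)         x≢y = ⊥-elim (x≢y refl)
  distinct-on-edge⇒adjacent (b ∷ [ z ]) _ (here _ _)         (there _ here-end) _   = b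
  distinct-on-edge⇒adjacent (b ∷ [ z ]) _ (there _ here-end) (here _ _)         _   = Adj-sym b
  distinct-on-edge⇒adjacent (b ∷ [ z ]) _ (there _ here-end) (there _ here-end) x≢y = ⊥-elim (x≢y refl)
  distinct-on-edge⇒adjacent (_ ∷ (_ ∷ _)) (s≤s ())

  module _ {S : Pred (V G) 0ℓ} (independent : Independent G S) where

    onWalk-tail : ∀ {u w v k x} {a : Adj u w} {p : Walk G w v k} →
      u ∉ S → x ∈ S → _OnWalk_ G x (a ∷ p) → _OnWalk_ G x p
    onWalk-tail u∉S x∈S (here _ _)   = ⊥-elim (u∉S x∈S)
    onWalk-tail _   _   (there _ x∈p) = x∈p

    short-walk-from-outside-¬ContainsTwo : ∀ {u v k} → u ∉ S →
      (p : Walk G u v k) → k ≤ 2 → ¬ ContainsTwo G S p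
    short-walk-from-outside-¬ContainsTwo u∉S [ u ] _ (_ , _ , x∈S , _ , _ , here-end , _) =
      u∉S x∈S
    short-walk-from-outside-¬ContainsTwo u∉S (a ∷ p) (s≤s k≤1) (_ , _ , x∈S , y∈S , x≢y , x∈ap , y∈ap) =
      independent x∈S y∈S
        (distinct-on-edge⇒adjacent p k≤1
          (onWalk-tail u∉S x∈S x∈ap) (onWalk-tail u∉S y∈S y∈ap) x≢y)

  shortest-length-≤-diameter : ∀ {d u v k} → HasDiameter G d →
    (p : Walk G u v k) → Shortest G p → k ≤ d
  shortest-length-≤-diameter {u = u} {v = v} (bounded , _) p shortest
    with bounded u v
  ... | k′ , k′≤d , q , _ = ≤-trans (shortest k′ q) k′≤d

  diameter-two-independent-terminal-covers : HasDiameter G 2 →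
    {S : Pred (V G) 0ℓ} → Terminal G S → Independent G S → ∀ x → ¬ x ∉ S
  diameter-two-independent-terminal-covers diameter-two (_ , terminal) independent x x∉S
    with terminal x x∉S
  ... | _ , _ , p , shortest , two =
    short-walk-from-outside-¬ContainsTwo independent x∉S p
      (shortest-length-≤-diameter diameter-two p shortest) two

lemma4p1 : (G : Graph) → HasDiameter G 2 → (S : Pred (V G) 0ℓ) → Terminal G S → ¬ Independent G S
lemma4p1 G diameter-two@(_ , (u , _ , (a ∷ _) , _)) S terminal independent =
  covers u λ u∈S → covers _ λ w∈S → independent u∈S w∈S a
  where
  covers : ∀ x → ¬ x ∉ S
  covers = diameter-two-independent-terminal-covers G diameter-two terminal independent
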